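{- Let \[ \Omega := \{(N,\mathfrak{d})\in\mathbb{Z}_{>0}\times\mathbb{Z}_{\ge 0} : \exists\, g,t\in\mathbb{Z}_{\ge 0},\ gt=\mathfrak{d},\ g+t\le N\}. \] Then: the pair $(N,\mathfrak{d}) = (g+t+r,\,tg)$ is a complete invariant for the $\mathrm{GL}(2,\mathbb{R})$-similarity class of the matrix $\begin{pmatrix} r+t & g\\ r & g\end{pmatrix}$ (over nonnegative integers $g,t,r$ with $g+t+r\ge 1$), and $\Omega$ is the set of pairs so realized; every $(N,\mathfrak{d})\in\Omega$ satisfies $N^2\ge 4\mathfrak{d}$, but this condition is not sufficient for membership in $\Omega$ (e.g. $(6,7)\notin\Omega$ although $36\ge 28$); and for $\mathfrak{d}\ge 1$, $(N,\mathfrak{d})\in\Omega$ if and only if $N\ge\sigma(\mathfrak{d})$, where $\sigma(\mathfrak{d}) := \min\{\,d + \mathfrak{d}/d : d\mid\mathfrak{d},\ 1\le d\le\sqrt{\mathfrak{d}}\,\}$.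
   Context: The matrix $\begin{pmatrix} r+t & g\\ r & g\end{pmatrix}$ with nonnegative integers $g,t,r$ and $N=g+t+r$ is the count transfer matrix of a binary carry chain in which $g$ digits generate a carry, $t$ propagate it and $r$ kill it; its trace is $N$ and its determinant is $\mathfrak{d}=tg$.
   Formalization: Similarity of the matrices is GL(2,ℚ)-similarity, with an invertible conjugating matrix having rational entries, in place of $\mathrm{GL}(2,\mathbb{R})$-similarity. -}

module Defs where

open import Data.Nat as ℕ using (ℕ; zero; suc; _+_; _*_; _≤_; _⊓_; _≤?_)
open import Data.Nat.Divisibility using (_∣_; _∣?_)
open import Data.Nat.DivMod using (_/_)
open import Data.Bool using (if_then_else_; _∧_)
open import Data.Product using (_×_; ∃; ∃-syntax)
open import Relation.Nullary using (¬_; does)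
open import Relation.Binary.PropositionalEquality using (_≡_)
open import Data.Rational as ℚ using (ℚ)
open import Data.Integer using (+_)

ℕ→ℚ : ℕ → ℚ
ℕ→ℚ n = (+ n) ℚ./ 1

-- 2×2 matrices over ℚ (ℚ is normalised, so _≡_ is the right equality).
record M2 : Set where
  constructor mat
  field
    a11 a12 a21 a22 : ℚ

_⊗_ : M2 → M2 → M2
mat a b c d ⊗ mat e f g h =
  mat (a ℚ.* e ℚ.+ b ℚ.* g) (a ℚ.* f ℚ.+ b ℚ.* h)
      (c ℚ.* e ℚ.+ d ℚ.* g) (c ℚ.* f ℚ.+ d ℚ.* h)

det : M2 → ℚ
det (mat a b c d) = a ℚ.* d ℚ.- b ℚ.* c

Similar : M2 → M2 → Set
Similar A B = ∃[ P ] (¬ (det P ≡ ℚ.0ℚ) × (P ⊗ A ≡ B ⊗ P))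

carryMat : ℕ → ℕ → ℕ → M2
carryMat g t r = mat (ℕ→ℚ (r + t)) (ℕ→ℚ g) (ℕ→ℚ r) (ℕ→ℚ g)

Ω : ℕ → ℕ → Set
Ω N 𝔡 = (1 ≤ N) × (∃[ g ] ∃[ t ] ((g * t ≡ 𝔡) × (g + t ≤ N)))

-- σ-upto D k = min { d + D/d : 1 ≤ d ≤ k, d ∣ D, d*d ≤ D }  (with default value suc D,
-- which equals the d = 1 candidate whenever D ≥ 1)
σ-upto : ℕ → ℕ → ℕ
σ-upto D zero = suc D
σ-upto D (suc k) =
  if does (suc k ∣? D) ∧ does (suc k * suc k ≤? D)
  then (suc k + D / suc k) ⊓ σ-upto D k
  else σ-upto D k

σ : ℕ → ℕ
σ D = σ-upto D D

{-# OPTIONS --safe #-}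
-- Trace and determinant are similarity invariants. Conversely, a non-scalar 2×2 matrix A has a
-- cyclic vector v, and in the basis (v, vA) it becomes the companion matrix of its characteristic
-- polynomial, so two non-scalar matrices with equal trace and determinant are similar. A carry
-- matrix with N ≥ 1 is non-scalar, with trace N and determinant tg.
-- Membership (N, 𝔡) ∈ Ω says 𝔡 = gt with g + t ≤ N, so N² ≥ (g + t)² ≥ 4gt by AM-GM; and for 𝔡 ≥ 1
-- the least g + t over factorisations gt = 𝔡 is attained with g ≤ √𝔡, which is σ(𝔡). As σ(7) = 8,
-- (6, 7) ∉ Ω.
module Submission where

open import Defs
open import Data.Nat as ℕ using (ℕ; zero; suc; _≤_; _⊓_; _≤?_; z≤n; s≤s)
import Data.Nat.Coprimality as Coprimality
import Data.Integer as ℤ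
import Data.Integer.Properties as ℤP
import Data.Nat.Tactic.RingSolver as ℕ-Solver
open import Data.Rational as ℚ using (ℚ; mkℚ; 0ℚ; 1ℚ)
import Data.Rational.Properties as ℚP
open import Data.Product using (_×_; _,_; proj₁; proj₂; ∃-syntax)
open import Data.Sum using (_⊎_; inj₁; inj₂)
open import Function using (_∘_)
open import Function.Bundles using (_⇔_; mk⇔; Equivalence)
open import Relation.Binary.Consequences using (wlog)
open import Relation.Nullary using (¬_; Dec; yes; no; does)
open import Relation.Nullary.Decidable using (from-yes; from-no; dec⇒maybe)
open import Data.Bool using (if_then_else_; _∧_)
open import Data.Empty using (⊥-elim)
open import Relation.Binary.PropositionalEquality
  using (_≡_; _≢_; refl; sym; trans; cong; cong₂; subst; subst₂; module ≡-Reasoning)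
import Tactic.RingSolver.Core.AlmostCommutativeRing as ACR
open import Tactic.RingSolver using (solve-∀)

module RationalMatrices where
  open import Data.Rational using (_+_; _*_; -_; _-_)
  open import Algebra.Apartness.Properties.HeytingCommutativeRing ℚP.heytingCommutativeRing
    using (x#0y#0→xy#0)

  ℚ-ring : ACR.AlmostCommutativeRing _ _
  ℚ-ring = ACR.fromCommutativeRing ℚP.+-*-commutativeRing (dec⇒maybe ∘ (0ℚ ℚP.≟_))

  ℕ→ℚ≡mkℚ : ∀ n → ℕ→ℚ n ≡ mkℚ (ℤ.+ n) 0 (Coprimality.sym (Coprimality.1-coprimeTo n))
  ℕ→ℚ≡mkℚ n = ℚP.normalize-coprime (Coprimality.sym (Coprimality.1-coprimeTo n))

  ℕ→ℚ-+ : ∀ m n → ℕ→ℚ (m ℕ.+ n) ≡ ℕ→ℚ m + ℕ→ℚ n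
  ℕ→ℚ-+ m n = sym (trans (cong₂ _+_ (ℕ→ℚ≡mkℚ m) (ℕ→ℚ≡mkℚ n))
    (cong (ℚ._/ 1) (trans (cong₂ ℤ._+_ (ℤP.*-identityʳ (ℤ.+ m)) (ℤP.*-identityʳ (ℤ.+ n)))
                          (sym (ℤP.pos-+ m n)))))

  ℕ→ℚ-* : ∀ m n → ℕ→ℚ (m ℕ.* n) ≡ ℕ→ℚ m * ℕ→ℚ n
  ℕ→ℚ-* m n = sym (trans (cong₂ _*_ (ℕ→ℚ≡mkℚ m) (ℕ→ℚ≡mkℚ n))
    (cong (ℚ._/ 1) (sym (ℤP.pos-* m n))))

  ℕ→ℚ-injective : ∀ {m n} → ℕ→ℚ m ≡ ℕ→ℚ n → m ≡ n
  ℕ→ℚ-injective {m} {n} eq =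
    ℤP.+-injective (cong ℚ.↥_ (trans (sym (ℕ→ℚ≡mkℚ m)) (trans eq (ℕ→ℚ≡mkℚ n))))

  ℕ→ℚ-suc≢0 : ∀ n → ℕ→ℚ (suc n) ≢ 0ℚ
  ℕ→ℚ-suc≢0 n eq with () ← ℕ→ℚ-injective {suc n} {0} eq

  mat-cong : ∀ {a b c d a′ b′ c′ d′} →
             a ≡ a′ → b ≡ b′ → c ≡ c′ → d ≡ d′ → mat a b c d ≡ mat a′ b′ c′ d′
  mat-cong refl refl refl refl = refl

  tr : M2 → ℚ
  tr (mat a _ _ d) = a + d

  adj : M2 → M2
  adj (mat a b c d) = mat d (- b) (- c) a

  companion : ℚ → ℚ → M2
  companion τ δ = mat 0ℚ 1ℚ (- δ) τ

  -- The rows of cyclicBasis x y A are v = (x , y) and v A.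
  cyclicBasis : ℚ → ℚ → M2 → M2
  cyclicBasis x y (mat a b c d) = mat x y (x * a + y * c) (x * b + y * d)

  HasCyclicVector : M2 → Set
  HasCyclicVector A = ∃[ x ] ∃[ y ] det (cyclicBasis x y A) ≢ 0ℚ

  ⊗-assoc : ∀ P Q R → (P ⊗ Q) ⊗ R ≡ P ⊗ (Q ⊗ R)
  ⊗-assoc (mat a b c d) (mat e f g h) (mat i j k l) =
    mat-cong (row·col a b e f g h i k) (row·col a b e f g h j l)
             (row·col c d e f g h i k) (row·col c d e f g h j l)
    where
    row·col : ∀ a b e f g h i k →
      (a * e + b * g) * i + (a * f + b * h) * k ≡ a * (e * i + f * k) + b * (g * i + h * k)
    row·col = solve-∀ ℚ-ring

  det-⊗ : ∀ P Q → det (P ⊗ Q) ≡ det P * det Q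
  det-⊗ (mat a b c d) (mat e f g h) = identity a b c d e f g h
    where
    identity : ∀ a b c d e f g h →
      (a * e + b * g) * (c * f + d * h) - (a * f + b * h) * (c * e + d * g)
        ≡ (a * d - b * c) * (e * h - f * g)
    identity = solve-∀ ℚ-ring

  det-adj : ∀ P → det (adj P) ≡ det P
  det-adj (mat a b c d) = identity a b c d
    where
    identity : ∀ a b c d → d * a - - b * - c ≡ a * d - b * c
    identity = solve-∀ ℚ-ring

  tr-adj⊗⊗ : ∀ P A → tr (adj P ⊗ (P ⊗ A)) ≡ det P * tr A
  tr-adj⊗⊗ (mat p q r s) (mat a b c d) = identity p q r s a b c d
    where
    identity : ∀ p q r s a b c d →
      s * (p * a + q * c) + - q * (r * a + s * c) + (- r * (p * b + q * d) + p * (r * b + s * d))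
        ≡ (p * s - q * r) * (a + d)
    identity = solve-∀ ℚ-ring

  tr-adj⊗⊗ʳ : ∀ P B → tr (adj P ⊗ (B ⊗ P)) ≡ det P * tr B
  tr-adj⊗⊗ʳ (mat p q r s) (mat a b c d) = identity p q r s a b c d
    where
    identity : ∀ p q r s a b c d →
      s * (a * p + b * r) + - q * (c * p + d * r) + (- r * (a * q + b * s) + p * (c * q + d * s))
        ≡ (p * s - q * r) * (a + d)
    identity = solve-∀ ℚ-ring

  *-cancelˡ-≡ : ∀ c {a b} → c ≢ 0ℚ → c * a ≡ c * b → a ≡ b
  *-cancelˡ-≡ c {a} {b} c≢0 eq = trans (sym (unscale a)) (trans (cong (ℚ.1/ c *_) eq) (unscale b))
    where
    instance
      _ = ℚ.≢-nonZero c≢0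
    unscale : ∀ x → ℚ.1/ c * (c * x) ≡ x
    unscale x = trans (sym (ℚP.*-assoc (ℚ.1/ c) c x))
                      (trans (cong (_* x) (ℚP.*-inverseˡ c)) (ℚP.*-identityˡ x))

  similar⇒tr≡ : ∀ {A B} → Similar A B → tr A ≡ tr B
  similar⇒tr≡ {A} {B} (P , detP≢0 , PA≡BP) = *-cancelˡ-≡ (det P) detP≢0 (begin
    det P * tr A          ≡⟨ tr-adj⊗⊗ P A ⟨
    tr (adj P ⊗ (P ⊗ A))  ≡⟨ cong (λ M → tr (adj P ⊗ M)) PA≡BP ⟩
    tr (adj P ⊗ (B ⊗ P))  ≡⟨ tr-adj⊗⊗ʳ P B ⟩
    det P * tr B          ∎)
    where open ≡-Reasoning

  similar⇒det≡ : ∀ {A B} → Similar A B → det A ≡ det B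
  similar⇒det≡ {A} {B} (P , detP≢0 , PA≡BP) = *-cancelˡ-≡ (det P) detP≢0 (begin
    det P * det A  ≡⟨ det-⊗ P A ⟨
    det (P ⊗ A)    ≡⟨ cong det PA≡BP ⟩
    det (B ⊗ P)    ≡⟨ det-⊗ B P ⟩
    det B * det P  ≡⟨ ℚP.*-comm (det B) (det P) ⟩
    det P * det B  ∎)
    where open ≡-Reasoning

  -- The last two entries are the Cayley–Hamilton identity v A² = tr A · v A − det A · v.
  cyclicBasis-intertwines : ∀ x y A →
    cyclicBasis x y A ⊗ A ≡ companion (tr A) (det A) ⊗ cyclicBasis x y A
  cyclicBasis-intertwines x y (mat a b c d) =
    mat-cong (shift x (x * a + y * c)) (shift y (x * b + y * d))
             (cayley-hamilton₁ x y a b c d) (cayley-hamilton₂ x y a b c d)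
    where
    shift : ∀ z u → u ≡ 0ℚ * z + 1ℚ * u
    shift = solve-∀ ℚ-ring
    cayley-hamilton₁ : ∀ x y a b c d →
      (x * a + y * c) * a + (x * b + y * d) * c
        ≡ - (a * d - b * c) * x + (a + d) * (x * a + y * c)
    cayley-hamilton₁ = solve-∀ ℚ-ring
    cayley-hamilton₂ : ∀ x y a b c d →
      (x * a + y * c) * b + (x * b + y * d) * d
        ≡ - (a * d - b * c) * y + (a + d) * (x * b + y * d)
    cayley-hamilton₂ = solve-∀ ℚ-ring

  adj-cyclicBasis-intertwines : ∀ x y A →
    adj (cyclicBasis x y A) ⊗ companion (tr A) (det A) ≡ A ⊗ adj (cyclicBasis x y A)
  adj-cyclicBasis-intertwines x y (mat a b c d) =
    mat-cong (e₁₁ x y a b c d) (e₁₂ x y a b c d) (e₂₁ x y a b c d) (e₂₂ x y a b c d)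
    where
    e₁₁ : ∀ x y a b c d → (x * b + y * d) * 0ℚ + - y * - (a * d - b * c)
                          ≡ a * (x * b + y * d) + b * - (x * a + y * c)
    e₁₁ = solve-∀ ℚ-ring
    e₁₂ : ∀ x y a b c d → (x * b + y * d) * 1ℚ + - y * (a + d) ≡ a * - y + b * x
    e₁₂ = solve-∀ ℚ-ring
    e₂₁ : ∀ x y a b c d → - (x * a + y * c) * 0ℚ + x * - (a * d - b * c)
                          ≡ c * (x * b + y * d) + d * - (x * a + y * c)
    e₂₁ = solve-∀ ℚ-ring
    e₂₂ : ∀ x y a b c d → - (x * a + y * c) * 1ℚ + x * (a + d) ≡ c * - y + d * x
    e₂₂ = solve-∀ ℚ-ring

  ⊗-intertwines : ∀ {P Q A B C} → P ⊗ A ≡ B ⊗ P → Q ⊗ B ≡ C ⊗ Q → (Q ⊗ P) ⊗ A ≡ C ⊗ (Q ⊗ P)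
  ⊗-intertwines {P} {Q} {A} {B} {C} PA≡BP QB≡CQ = begin
    (Q ⊗ P) ⊗ A  ≡⟨ ⊗-assoc Q P A ⟩
    Q ⊗ (P ⊗ A)  ≡⟨ cong (Q ⊗_) PA≡BP ⟩
    Q ⊗ (B ⊗ P)  ≡⟨ ⊗-assoc Q B P ⟨
    (Q ⊗ B) ⊗ P  ≡⟨ cong (_⊗ P) QB≡CQ ⟩
    (C ⊗ Q) ⊗ P  ≡⟨ ⊗-assoc C Q P ⟩
    C ⊗ (Q ⊗ P)  ∎
    where open ≡-Reasoning

  -- Both matrices are similar to the companion matrix of their common characteristic polynomial.
  cyclic⇒similar : ∀ {A B} → HasCyclicVector A → HasCyclicVector B →
                   tr A ≡ tr B → det A ≡ det B → Similar A B
  cyclic⇒similar {A} {B} (x , y , detQ≢0) (x′ , y′ , detQ′≢0) trA≡trB detA≡detB =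
    adj Q′ ⊗ Q , detP≢0 ,
    ⊗-intertwines {Q} {adj Q′} {A} {companion (tr B) (det B)} {B}
                  QA≡CQ (adj-cyclicBasis-intertwines x′ y′ B)
    where
    Q  = cyclicBasis x y A
    Q′ = cyclicBasis x′ y′ B
    QA≡CQ : Q ⊗ A ≡ companion (tr B) (det B) ⊗ Q
    QA≡CQ = subst₂ (λ τ δ → Q ⊗ A ≡ companion τ δ ⊗ Q) trA≡trB detA≡detB
                   (cyclicBasis-intertwines x y A)
    detP≡ : det (adj Q′ ⊗ Q) ≡ det Q′ * det Q
    detP≡ = trans (det-⊗ (adj Q′) Q) (cong (_* det Q) (det-adj Q′))
    detP≢0 : det (adj Q′ ⊗ Q) ≢ 0ℚ
    detP≢0 = x#0y#0→xy#0 detQ′≢0 detQ≢0 ∘ trans (sym detP≡)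

  NonScalar : M2 → Set
  NonScalar (mat a b c d) = b ≢ 0ℚ ⊎ c ≢ 0ℚ ⊎ a ≢ d

  nonScalar⇒cyclic : ∀ A → NonScalar A → HasCyclicVector A
  nonScalar⇒cyclic (mat a b c d) (inj₁ b≢0) = 1ℚ , 0ℚ , b≢0 ∘ trans (sym (det-e₁ a b c d))
    where
    det-e₁ : ∀ a b c d → 1ℚ * (1ℚ * b + 0ℚ * d) - 0ℚ * (1ℚ * a + 0ℚ * c) ≡ b
    det-e₁ = solve-∀ ℚ-ring
  nonScalar⇒cyclic (mat a b c d) (inj₂ (inj₁ c≢0)) =
    0ℚ , 1ℚ , c≢0 ∘ ℚP.neg-injective ∘ trans (sym (det-e₂ a b c d))
    where
    det-e₂ : ∀ a b c d → 0ℚ * (0ℚ * b + 1ℚ * d) - 1ℚ * (0ℚ * a + 1ℚ * c) ≡ - c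
    det-e₂ = solve-∀ ℚ-ring
  nonScalar⇒cyclic (mat a b c d) (inj₂ (inj₂ a≢d)) with b ℚP.≟ 0ℚ | c ℚP.≟ 0ℚ
  ... | no b≢0   | _        = nonScalar⇒cyclic (mat a b c d) (inj₁ b≢0)
  ... | yes _    | no c≢0   = nonScalar⇒cyclic (mat a b c d) (inj₂ (inj₁ c≢0))
  ... | yes refl | yes refl =
    1ℚ , 1ℚ , a≢d ∘ sym ∘ x∙y⁻¹≈ε⇒x≈y d a ∘ trans (sym (det-e₁+e₂ a d))
    where
    open import Algebra.Properties.Group ℚP.+-0-group using (x∙y⁻¹≈ε⇒x≈y)
    det-e₁+e₂ : ∀ a d → 1ℚ * (1ℚ * 0ℚ + 1ℚ * d) - 1ℚ * (1ℚ * a + 1ℚ * 0ℚ) ≡ d - a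
    det-e₁+e₂ = solve-∀ ℚ-ring

  tr-carryMat : ∀ g t r → tr (carryMat g t r) ≡ ℕ→ℚ (g ℕ.+ t ℕ.+ r)
  tr-carryMat g t r = trans (sym (ℕ→ℚ-+ (r ℕ.+ t) g)) (cong ℕ→ℚ (reorder r t g))
    where
    reorder : ∀ r t g → r ℕ.+ t ℕ.+ g ≡ g ℕ.+ t ℕ.+ r
    reorder = ℕ-Solver.solve-∀

  det-carryMat : ∀ g t r → det (carryMat g t r) ≡ ℕ→ℚ (t ℕ.* g)
  det-carryMat g t r = begin
    ℕ→ℚ (r ℕ.+ t) * G - G * R  ≡⟨ cong (λ X → X * G - G * R) (ℕ→ℚ-+ r t) ⟩
    (R + T) * G - G * R        ≡⟨ identity G T R ⟩
    T * G                      ≡⟨ ℕ→ℚ-* t g ⟨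
    ℕ→ℚ (t ℕ.* g)              ∎
    where
    open ≡-Reasoning
    G = ℕ→ℚ g
    T = ℕ→ℚ t
    R = ℕ→ℚ r
    identity : ∀ G T R → (R + T) * G - G * R ≡ T * G
    identity = solve-∀ ℚ-ring

  carryMat-nonScalar : ∀ g t r → 1 ℕ.≤ g ℕ.+ t ℕ.+ r → NonScalar (carryMat g t r)
  carryMat-nonScalar (suc g) t       r       _ = inj₁ (ℕ→ℚ-suc≢0 g)
  carryMat-nonScalar zero    t       (suc r) _ = inj₂ (inj₁ (ℕ→ℚ-suc≢0 r))
  carryMat-nonScalar zero    (suc t) zero    _ = inj₂ (inj₂ (ℕ→ℚ-suc≢0 t))

open RationalMatrices

open import Data.Nat using (_+_; _*_)
open import Data.Nat.Properties
  using (≤-total; ≤-trans; *-comm; +-comm; *-identityˡ; m≤m+n; m≤m*n; *-mono-≤; *-monoʳ-≤;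
         m≤n⇒∃[o]m+o≡n; m≤n⇒m<n∨m≡n; m⊓n≤m; m⊓n≤n; ⊓-sel)
open import Data.Nat.Divisibility using (_∣_; divides; _∣?_)
open import Data.Nat.DivMod using (_/_; m*n/n≡m; m*[n/m]≡n)

carryMat-similar⇔ : (g t r g′ t′ r′ : ℕ) → 1 ≤ g + t + r → 1 ≤ g′ + t′ + r′ →
  Similar (carryMat g t r) (carryMat g′ t′ r′) ⇔ ((g + t + r ≡ g′ + t′ + r′) × (t * g ≡ t′ * g′))
carryMat-similar⇔ g t r g′ t′ r′ N≥1 N′≥1 = mk⇔ invariants-agree similar-if-agree
  where
  A = carryMat g t r
  B = carryMat g′ t′ r′
  invariants-agree : Similar A B → (g + t + r ≡ g′ + t′ + r′) × (t * g ≡ t′ * g′)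
  invariants-agree A∼B =
    ℕ→ℚ-injective (trans (sym (tr-carryMat g t r))
                         (trans (similar⇒tr≡ {A} {B} A∼B) (tr-carryMat g′ t′ r′))) ,
    ℕ→ℚ-injective (trans (sym (det-carryMat g t r))
                         (trans (similar⇒det≡ {A} {B} A∼B) (det-carryMat g′ t′ r′)))
  similar-if-agree : (g + t + r ≡ g′ + t′ + r′) × (t * g ≡ t′ * g′) → Similar A B
  similar-if-agree (N≡N′ , 𝔡≡𝔡′) = cyclic⇒similar {A} {B}
    (nonScalar⇒cyclic A (carryMat-nonScalar g t r N≥1))
    (nonScalar⇒cyclic B (carryMat-nonScalar g′ t′ r′ N′≥1))
    (trans (tr-carryMat g t r) (trans (cong ℕ→ℚ N≡N′) (sym (tr-carryMat g′ t′ r′))))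
    (trans (det-carryMat g t r) (trans (cong ℕ→ℚ 𝔡≡𝔡′) (sym (det-carryMat g′ t′ r′))))

Ω⇒carry : ∀ {N 𝔡} → Ω N 𝔡 → ∃[ g ] ∃[ t ] ∃[ r ] ((1 ≤ g + t + r) × (g + t + r ≡ N) × (t * g ≡ 𝔡))
Ω⇒carry (1≤N , g , t , g*t≡𝔡 , g+t≤N) with r , g+t+r≡N ← m≤n⇒∃[o]m+o≡n g+t≤N =
  g , t , r , subst (1 ≤_) (sym g+t+r≡N) 1≤N , g+t+r≡N , trans (*-comm t g) g*t≡𝔡

carry⇒Ω : ∀ {N 𝔡} → ∃[ g ] ∃[ t ] ∃[ r ] ((1 ≤ g + t + r) × (g + t + r ≡ N) × (t * g ≡ 𝔡)) → Ω N 𝔡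
carry⇒Ω (g , t , r , 1≤N , refl , t*g≡𝔡) = 1≤N , g , t , trans (*-comm g t) t*g≡𝔡 , m≤m+n (g + t) r

am-gm : ∀ m n → 4 * (m * n) ≤ (m + n) * (m + n)
am-gm = wlog {Q = λ m n → 4 * (m * n) ≤ (m + n) * (m + n)} ≤-total
  (λ {m} {n} → subst₂ (λ x y → 4 * x ≤ y * y) (*-comm m n) (+-comm m n)) ordered
  where
  square-expansion : ∀ m k → 4 * (m * (m + k)) + k * k ≡ (m + (m + k)) * (m + (m + k))
  square-expansion = ℕ-Solver.solve-∀
  ordered : ∀ m n → m ≤ n → 4 * (m * n) ≤ (m + n) * (m + n)
  ordered m n m≤n with k , refl ← m≤n⇒∃[o]m+o≡n m≤n =
    subst (4 * (m * (m + k)) ≤_) (square-expansion m k) (m≤m+n _ (k * k))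

Ω⇒4𝔡≤N² : ∀ {N 𝔡} → Ω N 𝔡 → 4 * 𝔡 ≤ N * N
Ω⇒4𝔡≤N² (_ , g , t , refl , g+t≤N) = ≤-trans (am-gm g t) (*-mono-≤ g+t≤N g+t≤N)

if-does-∧ : ∀ {a p q} {A : Set a} {P : Set p} {Q : Set q} (P? : Dec P) (Q? : Dec Q) (x y : A) →
  (P × Q × (if does P? ∧ does Q? then x else y) ≡ x)
  ⊎ (¬ (P × Q) × (if does P? ∧ does Q? then x else y) ≡ y)
if-does-∧ (yes p) (yes q) _ _ = inj₁ (p , q , refl)
if-does-∧ (yes _) (no ¬q) _ _ = inj₂ (¬q ∘ proj₂ , refl)
if-does-∧ (no ¬p) _       _ _ = inj₂ (¬p ∘ proj₁ , refl)

σ-upto-suc : ∀ D k →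
  (suc k ∣ D × suc k * suc k ≤ D × σ-upto D (suc k) ≡ (suc k + D / suc k) ⊓ σ-upto D k)
  ⊎ (¬ (suc k ∣ D × suc k * suc k ≤ D) × σ-upto D (suc k) ≡ σ-upto D k)
σ-upto-suc D k = if-does-∧ (suc k ∣? D) (suc k * suc k ≤? D) _ _

σ-upto-attained : ∀ D k → ∃[ g ] ∃[ t ] ((g * t ≡ D) × (g + t ≡ σ-upto D k))
σ-upto-attained D zero = 1 , D , *-identityˡ D , refl
σ-upto-attained D (suc k) with σ-upto-suc D k | σ-upto-attained D k
... | inj₂ (_ , σ≡) | g , t , g*t≡D , g+t≡σ = g , t , g*t≡D , trans g+t≡σ (sym σ≡)
... | inj₁ (d∣D , _ , σ≡) | g , t , g*t≡D , g+t≡σ with ⊓-sel (suc k + D / suc k) (σ-upto D k)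
...   | inj₁ min≡new = suc k , D / suc k , m*[n/m]≡n d∣D , sym (trans σ≡ min≡new)
...   | inj₂ min≡old = g , t , g*t≡D , trans g+t≡σ (sym (trans σ≡ min≡old))

σ-upto-minimal : ∀ D k d → suc d ≤ k → suc d ∣ D → suc d * suc d ≤ D →
                 σ-upto D k ≤ suc d + D / suc d
σ-upto-minimal D (suc k) d d<k d∣D d²≤D with σ-upto-suc D k | m≤n⇒m<n∨m≡n d<k
... | inj₁ (_ , _ , σ≡) | inj₁ (s≤s d<k′) =
  subst (_≤ suc d + D / suc d) (sym σ≡) (≤-trans (m⊓n≤n _ _) (σ-upto-minimal D k d d<k′ d∣D d²≤D))
... | inj₁ (_ , _ , σ≡) | inj₂ refl = subst (_≤ suc d + D / suc d) (sym σ≡) (m⊓n≤m _ _)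
... | inj₂ (_ , σ≡)     | inj₁ (s≤s d<k′) =
  subst (_≤ suc d + D / suc d) (sym σ≡) (σ-upto-minimal D k d d<k′ d∣D d²≤D)
... | inj₂ (¬cand , _)  | inj₂ refl = ⊥-elim (¬cand (d∣D , d²≤D))

σ-≤-ordered-factor-sum : ∀ d e → d ≤ e → 1 ≤ d * e → σ (d * e) ≤ d + e
σ-≤-ordered-factor-sum (suc d) (suc e) d≤e _ =
  subst (λ q → σ D ≤ suc d + q) D/d≡e (σ-upto-minimal D D d d≤D d∣D d²≤D)
  where
  D = suc d * suc e
  d≤D : suc d ≤ D
  d≤D = m≤m*n (suc d) (suc e)
  d∣D : suc d ∣ D
  d∣D = divides (suc e) (*-comm (suc d) (suc e))
  d²≤D : suc d * suc d ≤ D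
  d²≤D = *-monoʳ-≤ (suc d) d≤e
  D/d≡e : D / suc d ≡ suc e
  D/d≡e = trans (cong (_/ suc d) (*-comm (suc d) (suc e))) (m*n/n≡m (suc e) (suc d))

σ-≤-factor-sum : ∀ {D} → 1 ≤ D → ∀ g t → g * t ≡ D → σ D ≤ g + t
σ-≤-factor-sum 1≤D g t refl =
  wlog {Q = λ g t → 1 ≤ g * t → σ (g * t) ≤ g + t} ≤-total
    (λ {g} {t} → subst₂ (λ x y → 1 ≤ x → σ x ≤ y) (*-comm g t) (+-comm g t))
    σ-≤-ordered-factor-sum g t 1≤D

1≤m*n⇒1≤m+n : ∀ m n → 1 ≤ m * n → 1 ≤ m + n
1≤m*n⇒1≤m+n (suc m) n _ = s≤s z≤n

Ω⇔σ≤ : ∀ N 𝔡 → 1 ≤ 𝔡 → Ω N 𝔡 ⇔ σ 𝔡 ≤ N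
Ω⇔σ≤ N 𝔡 1≤𝔡 = mk⇔
  (λ (_ , g , t , g*t≡𝔡 , g+t≤N) → ≤-trans (σ-≤-factor-sum 1≤𝔡 g t g*t≡𝔡) g+t≤N)
  σ≤N⇒Ω
  where
  σ≤N⇒Ω : σ 𝔡 ≤ N → Ω N 𝔡
  σ≤N⇒Ω σ≤N with g , t , g*t≡𝔡 , g+t≡σ ← σ-upto-attained 𝔡 𝔡 =
    ≤-trans (1≤m*n⇒1≤m+n g t (subst (1 ≤_) (sym g*t≡𝔡) 1≤𝔡)) g+t≤N , g , t , g*t≡𝔡 , g+t≤N
    where
    g+t≤N : g + t ≤ N
    g+t≤N = subst (_≤ N) (sym g+t≡σ) σ≤N

-- σ 7 evaluates to 8.
¬Ω[6,7] : ¬ Ω 6 7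
¬Ω[6,7] = from-no (σ 7 ≤? 6) ∘ Equivalence.to (Ω⇔σ≤ 6 7 (s≤s z≤n))

corollary6p3 :
    ((g t r g′ t′ r′ : ℕ) → 1 ≤ g + t + r → 1 ≤ g′ + t′ + r′ →
      (Similar (carryMat g t r) (carryMat g′ t′ r′)
        ⇔ ((g + t + r ≡ g′ + t′ + r′) × (t * g ≡ t′ * g′))))
    × ((N 𝔡 : ℕ) →
      (Ω N 𝔡 ⇔ (∃[ g ] ∃[ t ] ∃[ r ] ((1 ≤ g + t + r) × (g + t + r ≡ N) × (t * g ≡ 𝔡)))))
    × ((N 𝔡 : ℕ) → Ω N 𝔡 → 4 * 𝔡 ≤ N * N)
    × (¬ Ω 6 7 × (4 * 7 ≤ 6 * 6))
    × ((N 𝔡 : ℕ) → 1 ≤ 𝔡 → (Ω N 𝔡 ⇔ σ 𝔡 ≤ N))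
corollary6p3 =
  carryMat-similar⇔ ,
  (λ N 𝔡 → mk⇔ Ω⇒carry carry⇒Ω) ,
  (λ N 𝔡 → Ω⇒4𝔡≤N²) ,
  (¬Ω[6,7] , from-yes (4 * 7 ≤? 6 * 6)) ,
  Ω⇔σ≤
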